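{- Let $G_1$ and $G_2$ be simple graphs. The following are equivalent: (1) up to isomorphism, $G_2$ can be obtained from $G_1$ using edge pivots; (2) there is a compatible isomorphism $\beta:M(IAS(G_1))\to M(IAS(G_2))$ such that $f_\beta(v)\in\{1,(\phi\chi)\}$ for all $v\in V(G_1)$.
   Context: A simple graph has no loops or multiple edges. The simple local complement $G^v_s$ complements all adjacencies between distinct neighbors of $v$. For neighbors $v\ne w$, the edge pivot is $G^{vw}=((G^v_s)^w_s)^v_s$. $A(G)$ is the adjacency matrix over $GF(2)$. $M(IAS(G))$ is the binary matroid represented by the columns of $(I\mid A(G)\mid I+A(G))$; its ground set consists of columns $v_\phi,v_\chi,v_\psi$, the columns of $v$ in $I$, $A(G)$, $I+A(G)$. $S_3$ is the permutation group of $\{\phi,\chi,\psi\}$. A compatible isomorphism $\beta$ is a matroid isomorphism mapping each cell $\{v_\phi,v_\chi,v_\psi\}$ onto some cell; it induces a bijection $\beta:V(G_1)\to V(G_2)$ and $f_\beta:V(G_1)\to S_3$ with $\beta(v_\iota)=\beta(v)_{f_\beta(v)(\iota)}$. -}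

module Defs where

open import Data.Bool using (Bool; true; false; not; _∧_; _xor_; if_then_else_)
open import Data.Nat using (ℕ; zero; suc)
open import Data.Fin using (Fin; zero; suc; _≟_)
open import Data.Product using (Σ; _×_; _,_; proj₁; proj₂; ∃; ∃-syntax; Σ-syntax)
open import Data.Sum using (_⊎_)
open import Function.Bundles using (_↔_; Inverse)
open import Relation.Nullary using (¬_)
open import Relation.Nullary.Decidable using (⌊_⌋)
open import Relation.Binary.PropositionalEquality using (_≡_; _≢_)
open import Relation.Binary.Construct.Closure.ReflexiveTransitive using (Star)

-- Graphs on the vertex set Fin n, given by an adjacency function
-- (equivalently the adjacency matrix A(G) over GF(2), with Bool = GF(2),
-- xor = addition, ∧ = multiplication).

Adj : ℕ → Set
Adj n = Fin n → Fin n → Bool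

record Simple {n : ℕ} (A : Adj n) : Set where
  field
    irrefl : ∀ v → A v v ≡ false
    sym    : ∀ v w → A v w ≡ A w v

_==_ : ∀ {n} → Fin n → Fin n → Bool
x == y = ⌊ x ≟ y ⌋

localComp : ∀ {n} → Fin n → Adj n → Adj n
localComp v A x y =
  if not (x == y) ∧ A v x ∧ A v y then not (A x y) else A x y

pivot : ∀ {n} → Fin n → Fin n → Adj n → Adj n
pivot v w A = localComp v (localComp w (localComp v A))

data PivotStep {n : ℕ} (A : Adj n) : Adj n → Set where
  step : (v w : Fin n) → v ≢ w → A v w ≡ true → PivotStep A (pivot v w A)

Pivots : ∀ {n} → Adj n → Adj n → Set
Pivots = Star PivotStep

GraphIso : ∀ {n m} → Adj n → Adj m → Set
GraphIso {n} {m} A B =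
  Σ (Fin n ↔ Fin m) λ σ → ∀ x y → A x y ≡ B (Inverse.to σ x) (Inverse.to σ y)

PivotEquivalent : ∀ {n m} → Adj n → Adj m → Set
PivotEquivalent {n} A B = ∃[ H ] (Pivots A H × GraphIso H B)

-- The binary matroid M(IAS(G)), columns of (I | A | I + A)

data Cell : Set where
  φ χ ψ : Cell

-- ground set: the column v_ι for v a vertex, ι ∈ {φ, χ, ψ}
Ground : ℕ → Set
Ground n = Fin n × Cell

column : ∀ {n} → Adj n → Ground n → Fin n → Bool
column A (v , φ) i = i == v
column A (v , χ) i = A i v
column A (v , ψ) i = (i == v) xor A i v

xorSum : ∀ {n} → (Fin n → Bool) → Bool
xorSum {zero}  f = false
xorSum {suc n} f = f zero xor xorSum (λ i → f (suc i))

cellSum : (Cell → Bool) → Bool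
cellSum f = f φ xor (f χ xor f ψ)

sumColumns : ∀ {n} → Adj n → (Ground n → Bool) → Fin n → Bool
sumColumns A U i = xorSum λ v → cellSum λ ι → U (v , ι) ∧ column A (v , ι) i

-- subsets of the ground set are Bool-valued predicates
-- a set of columns is independent iff it is linearly independent over GF(2):
-- every subset whose columns sum to 0 is empty
Independent : ∀ {n} → Adj n → (Ground n → Bool) → Set
Independent {n} A T =
  (U : Ground n → Bool) → (∀ e → U e ≡ true → T e ≡ true) →
  (∀ i → sumColumns A U i ≡ false) → ∀ e → U e ≡ false

record MatroidIso {n m : ℕ} (A : Adj n) (B : Adj m) : Set where
  field
    bij      : Ground n ↔ Ground m
    preserve : ∀ (T : Ground n → Bool) →
               (Independent A T → Independent B (λ e → T (Inverse.from bij e)))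
               × (Independent B (λ e → T (Inverse.from bij e)) → Independent A T)

  β : Ground n → Ground m
  β = Inverse.to bij

Compatible : ∀ {n m} {A : Adj n} {B : Adj m} → MatroidIso A B → Set
Compatible {n} {m} b =
  Σ[ σ ∈ (Fin n → Fin m) ] ∀ (v : Fin n) (ι : Cell) → proj₁ (MatroidIso.β b (v , ι)) ≡ σ v

-- f_β(v) as a map Cell → Cell : β(v_ι) = β(v)_{f_β(v)(ι)}
fβ : ∀ {n m} {A : Adj n} {B : Adj m} → MatroidIso A B → Fin n → Cell → Cell
fβ b v ι = proj₂ (MatroidIso.β b (v , ι))

swapφχ : Cell → Cell
swapφχ φ = χ
swapφχ χ = φ
swapφχ ψ = ψ

InIdOrφχ : (Cell → Cell) → Set
InIdOrφχ f = (∀ ι → f ι ≡ ι) ⊎ (∀ ι → f ι ≡ swapφχ ι)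

module Submission where

-- An edge pivot on vw is realised on the columns of (I | A | I + A) by the invertible GF(2)-linear
-- map x ↦ x + x_v (e_w + A e_w) + x_w (e_v + A e_v): it sends each column of A to the column of
-- the pivot in the same cell, except that φ and χ are exchanged at v and w. So a sequence of
-- pivots followed by an isomorphism yields a compatible isomorphism with f_β ∈ {1, (φχ)}.
-- Conversely, such an isomorphism exchanges φ and χ exactly on some set S of vertices. If S is
-- empty the two graphs agree, because y_χ together with the φ-columns of the neighbours of y is
-- dependent. Otherwise each v ∈ S has a neighbour w ∈ S, and pivoting on wv removes v and w
-- from S; induction on |S| finishes the proof.

open import Data.Nat using (ℕ)
open import Data.Fin using (Fin)
open import Data.Product using (_×_; ∃-syntax)
open import Function.Bundles using (_⇔_)

open import Defs
open import Algebra.Bundles using (CommutativeRing)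
import Algebra.Properties.Semiring.Sum as SemiringSum
open import Data.Bool.Base using (Bool; true; false; not; _∧_; _xor_; if_then_else_)
open import Data.Bool.Properties as Bool
  using (xor-∧-commutativeRing; xor-identityʳ; xor-same; xor-assoc; xor-comm; ∧-comm; ∧-zeroʳ; ∧-identityʳ;
         ⇔→≡; ¬-not; not-¬)
open import Data.Bool.Solver using (module xor-∧-Solver)
open import Data.Empty using (⊥-elim)
open import Data.Fin.Base using (zero; suc)
open import Data.Fin.Properties using (_≟_; suc-injective; any?)
open import Data.Nat.Base using (_<_)
open import Data.Nat.Induction using (<-wellFounded)
import Data.Nat.Properties as ℕ
open import Data.Product using (_,_; proj₁; proj₂)
open import Data.Sum.Base using (inj₁; inj₂)
open import Function.Base using (_∘_; id)
open import Function.Bundles using (_↔_; Inverse; Injection; mk⇔; mk↔ₛ′)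
open import Function.Construct.Symmetry using (↔-sym)
open import Function.Properties.Inverse using (Inverse⇒Injection)
open import Induction.WellFounded using (Acc; acc)
open import Relation.Binary.Construct.Closure.ReflexiveTransitive using (ε; _◅_)
open import Relation.Binary.PropositionalEquality
open import Relation.Nullary using (¬_; Dec; yes; no)
open import Relation.Nullary.Decidable using (isYes≗does; dec-true; dec-false; _×-dec_)

open xor-∧-Solver using (solve; _:=_; _:+_; _:*_; con)
module Σ = SemiringSum (CommutativeRing.semiring xor-∧-commutativeRing)

private
  variable
    n m : ℕ

==-refl : (x : Fin n) → (x == x) ≡ true
==-refl x = trans (isYes≗does (x ≟ x)) (dec-true (x ≟ x) refl)

==-≢ : {x y : Fin n} → x ≢ y → (x == y) ≡ false
==-≢ {x = x} {y} x≢y = trans (isYes≗does (x ≟ y)) (dec-false (x ≟ y) x≢y)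

==-sym : (x y : Fin n) → (x == y) ≡ (y == x)
==-sym x y with x ≟ y
... | yes refl = sym (==-refl x)
... | no x≢y = sym (==-≢ (x≢y ∘ sym))

==-injective : {f : Fin n → Fin m} → (∀ {x y} → f x ≡ f y → x ≡ y) →
               ∀ x y → (f x == f y) ≡ (x == y)
==-injective {f = f} inj x y with x ≟ y
... | yes refl = ==-refl (f x)
... | no x≢y = ==-≢ (x≢y ∘ inj)

by-position : ∀ {p} {P : Fin n → Set p} (v w : Fin n) → P v → P w →
              (∀ i → i ≢ v → i ≢ w → P i) → ∀ i → P i
by-position v w pv pw rest i with i ≟ v | i ≟ w
... | yes refl | _ = pv
... | no _ | yes refl = pw
... | no i≢v | no i≢w = rest i i≢v i≢w

⊆-false : {a b : Bool} → (a ≡ true → b ≡ true) → b ≡ false → a ≡ false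
⊆-false {false} a⊆b b≡false = refl
⊆-false {true} a⊆b b≡false = sym (trans (sym b≡false) (a⊆b refl))

xor≡false⇒≡ : ∀ {a b} → a xor b ≡ false → a ≡ b
xor≡false⇒≡ {false} a⊕b≡0 = sym a⊕b≡0
xor≡false⇒≡ {true} {false} ()
xor≡false⇒≡ {true} {true} _ = refl

cong₃ : ∀ (f : Bool → Bool → Bool → Bool) {a a′ b b′ c c′} →
        a ≡ a′ → b ≡ b′ → c ≡ c′ → f a b c ≡ f a′ b′ c′
cong₃ f refl refl refl = refl

if-not≡xor : ∀ b c → (if b then not c else c) ≡ b xor c
if-not≡xor true  c = refl
if-not≡xor false c = refl

xorSum≡sum : (f : Fin n → Bool) → xorSum f ≡ Σ.sum f
xorSum≡sum {ℕ.zero} f = refl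
xorSum≡sum {ℕ.suc n} f = cong (f zero xor_) (xorSum≡sum (f ∘ suc))

xorSum-cong : {f g : Fin n → Bool} → (∀ u → f u ≡ g u) → xorSum f ≡ xorSum g
xorSum-cong {f = f} {g} f≗g = begin
  xorSum f  ≡⟨ xorSum≡sum f ⟩
  Σ.sum f   ≡⟨ Σ.sum-cong-≗ f≗g ⟩
  Σ.sum g   ≡⟨ xorSum≡sum g ⟨
  xorSum g  ∎
  where open ≡-Reasoning

xorSum-xor : (f g : Fin n → Bool) → xorSum (λ u → f u xor g u) ≡ xorSum f xor xorSum g
xorSum-xor f g = begin
  xorSum (λ u → f u xor g u)  ≡⟨ xorSum≡sum (λ u → f u xor g u) ⟩
  Σ.sum (λ u → f u xor g u)   ≡⟨ Σ.∑-distrib-+ f g ⟩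
  Σ.sum f xor Σ.sum g         ≡⟨ cong₂ _xor_ (xorSum≡sum f) (xorSum≡sum g) ⟨
  xorSum f xor xorSum g       ∎
  where open ≡-Reasoning

∧-distribʳ-xorSum : (c : Bool) (f : Fin n → Bool) → xorSum f ∧ c ≡ xorSum (λ u → f u ∧ c)
∧-distribʳ-xorSum c f = begin
  xorSum f ∧ c              ≡⟨ cong (_∧ c) (xorSum≡sum f) ⟩
  Σ.sum f ∧ c               ≡⟨ Σ.*-distribʳ-sum c f ⟩
  Σ.sum (λ u → f u ∧ c)     ≡⟨ xorSum≡sum (λ u → f u ∧ c) ⟨
  xorSum (λ u → f u ∧ c)    ∎
  where open ≡-Reasoning

xorSum-permute : (f : Fin m → Bool) (σ : Fin n ↔ Fin m) → xorSum f ≡ xorSum (f ∘ Inverse.to σ)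
xorSum-permute f σ = begin
  xorSum f                    ≡⟨ xorSum≡sum f ⟩
  Σ.sum f                     ≡⟨ Σ.sum-permute f σ ⟩
  Σ.sum (f ∘ Inverse.to σ)    ≡⟨ xorSum≡sum (f ∘ Inverse.to σ) ⟨
  xorSum (f ∘ Inverse.to σ)   ∎
  where open ≡-Reasoning

xorSum-zero : {f : Fin n → Bool} → (∀ u → f u ≡ false) → xorSum f ≡ false
xorSum-zero {n} {f} f≗0 = begin
  xorSum f             ≡⟨ xorSum-cong f≗0 ⟩
  xorSum {n} (λ _ → false) ≡⟨ xorSum≡sum {n} (λ _ → false) ⟩
  Σ.sum (λ (_ : Fin n) → false)  ≡⟨ Σ.sum-replicate-zero n ⟩
  false                ∎
  where open ≡-Reasoning

xorSum-single : (f : Fin n → Bool) (y : Fin n) → (∀ u → u ≢ y → f u ≡ false) → xorSum f ≡ f y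
xorSum-single f zero f≗0 =
  trans (cong (f zero xor_) (xorSum-zero (λ u → f≗0 (suc u) λ ())))
        (xor-identityʳ (f zero))
xorSum-single f (suc y) f≗0 rewrite f≗0 zero (λ ()) =
  xorSum-single (f ∘ suc) y (λ u u≢y → f≗0 (suc u) (u≢y ∘ suc-injective))

cellSum-cong : {f g : Cell → Bool} → (∀ ι → f ι ≡ g ι) → cellSum f ≡ cellSum g
cellSum-cong f≗g = cong₂ _xor_ (f≗g φ) (cong₂ _xor_ (f≗g χ) (f≗g ψ))

-- sumColumns A U is, definitionally, combination U (column A).
combination : (Ground n → Bool) → (Ground n → Fin m → Bool) → Fin m → Bool
combination U Y j = xorSum λ u → cellSum λ ι → U (u , ι) ∧ Y (u , ι) j

combination-cong : {U U′ : Ground n → Bool} {Y Y′ : Ground n → Fin m → Bool} →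
                   (∀ e → U e ≡ U′ e) → (∀ e j → Y e j ≡ Y′ e j) →
                   ∀ j → combination U Y j ≡ combination U′ Y′ j
combination-cong U≗U′ Y≗Y′ j = xorSum-cong λ u → cellSum-cong λ ι →
  cong₂ _∧_ (U≗U′ (u , ι)) (Y≗Y′ (u , ι) j)

addMultiples : Fin n → Fin n → (Fin n → Bool) → (Fin n → Bool) → (Fin n → Bool) → Fin n → Bool
addMultiples v w p q x i = x i xor ((x v ∧ p i) xor (x w ∧ q i))

addMultiples-xor : ∀ (v w : Fin n) p q x y i →
  addMultiples v w p q (λ j → x j xor y j) i ≡ addMultiples v w p q x i xor addMultiples v w p q y i
addMultiples-xor v w p q x y i = solve 8
  (λ xi xv xw yi yv yw P Q →
    (xi :+ yi) :+ (((xv :+ yv) :* P) :+ ((xw :+ yw) :* Q))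
    := (xi :+ ((xv :* P) :+ (xw :* Q))) :+ (yi :+ ((yv :* P) :+ (yw :* Q))))
  refl (x i) (x v) (x w) (y i) (y v) (y w) (p i) (q i)

addMultiples-combination : ∀ {n m} (v w : Fin m) p q (U : Ground n → Bool) Y i →
  addMultiples v w p q (combination U Y) i ≡ combination U (addMultiples v w p q ∘ Y) i
addMultiples-combination {n} {m} v w p q U Y i = begin
  C i xor ((C v ∧ p i) xor (C w ∧ q i))
    ≡⟨ cong₂ (λ a b → C i xor (a xor b)) (∧-distribʳ-xorSum (p i) (F v)) (∧-distribʳ-xorSum (q i) (F w)) ⟩
  C i xor (xorSum (λ u → F v u ∧ p i) xor xorSum (λ u → F w u ∧ q i))
    ≡⟨ cong (C i xor_) (xorSum-xor (λ u → F v u ∧ p i) (λ u → F w u ∧ q i)) ⟨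
  C i xor xorSum (λ u → (F v u ∧ p i) xor (F w u ∧ q i))
    ≡⟨ xorSum-xor (F i) (λ u → (F v u ∧ p i) xor (F w u ∧ q i)) ⟨
  xorSum (λ u → F i u xor ((F v u ∧ p i) xor (F w u ∧ q i)))
    ≡⟨ xorSum-cong (λ u → cellSum-addMultiples (U ∘ (u ,_)) (Y ∘ (u ,_))) ⟩
  combination U (addMultiples v w p q ∘ Y) i ∎
  where
  open ≡-Reasoning
  F : Fin m → Fin n → Bool
  F j u = cellSum λ ι → U (u , ι) ∧ Y (u , ι) j
  C : Fin m → Bool
  C = combination U Y
  cellSum-addMultiples : (V : Cell → Bool) (Z : Cell → Fin m → Bool) →
    cellSum (λ ι → V ι ∧ Z ι i) xor ((cellSum (λ ι → V ι ∧ Z ι v) ∧ p i) xor (cellSum (λ ι → V ι ∧ Z ι w) ∧ q i))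
    ≡ cellSum (λ ι → V ι ∧ addMultiples v w p q (Z ι) i)
  cellSum-addMultiples V Z = solve 14
    (λ V₁ V₂ V₃ a₁ a₂ a₃ b₁ b₂ b₃ c₁ c₂ c₃ P Q →
      ((V₁ :* a₁) :+ ((V₂ :* a₂) :+ (V₃ :* a₃))) :+
        ((((V₁ :* b₁) :+ ((V₂ :* b₂) :+ (V₃ :* b₃))) :* P) :+ (((V₁ :* c₁) :+ ((V₂ :* c₂) :+ (V₃ :* c₃))) :* Q))
      := (V₁ :* (a₁ :+ ((b₁ :* P) :+ (c₁ :* Q)))) :+ ((V₂ :* (a₂ :+ ((b₂ :* P) :+ (c₂ :* Q)))) :+ (V₃ :* (a₃ :+ ((b₃ :* P) :+ (c₃ :* Q))))))
    refl (V φ) (V χ) (V ψ) (Z φ i) (Z χ i) (Z ψ i) (Z φ v) (Z χ v) (Z ψ v) (Z φ w) (Z χ w) (Z ψ w) (p i) (q i)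

swapWhen : Bool → Cell → Cell
swapWhen true  ι = swapφχ ι
swapWhen false ι = ι

swapWhen-involutive : ∀ b ι → swapWhen b (swapWhen b ι) ≡ ι
swapWhen-involutive false ι = refl
swapWhen-involutive true  φ = refl
swapWhen-involutive true  χ = refl
swapWhen-involutive true  ψ = refl

swapWhen-xor : ∀ a b ι → swapWhen a (swapWhen b ι) ≡ swapWhen (a xor b) ι
swapWhen-xor false b     ι = refl
swapWhen-xor true  false ι = refl
swapWhen-xor true  true  ι = swapWhen-involutive true ι

swapWhen-ψ : ∀ b → swapWhen b ψ ≡ ψ
swapWhen-ψ false = refl
swapWhen-ψ true  = refl

swapWhen-InIdOrφχ : ∀ b → InIdOrφχ (swapWhen b)
swapWhen-InIdOrφχ false = inj₁ λ _ → refl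
swapWhen-InIdOrφχ true  = inj₂ λ _ → refl

cellSum-swapWhen : ∀ b (f : Cell → Bool) → cellSum (f ∘ swapWhen b) ≡ cellSum f
cellSum-swapWhen false f = refl
cellSum-swapWhen true  f = solve 3 (λ a b c → b :+ (a :+ c) := a :+ (b :+ c)) refl (f φ) (f χ) (f ψ)

column-ψ : ∀ (X : Adj n) u b i →
  column X (u , swapWhen b φ) i xor column X (u , swapWhen b χ) i ≡ column X (u , swapWhen b ψ) i
column-ψ X u false i = refl
column-ψ X u true  i = xor-comm (X i u) (i == u)

swapOn : (Fin n → Bool) → Ground n → Ground n
swapOn s (u , ι) = u , swapWhen (s u) ι

swapOn-involutive : (s : Fin n → Bool) → ∀ e → swapOn s (swapOn s e) ≡ e
swapOn-involutive s (u , ι) = cong (u ,_) (swapWhen-involutive (s u) ι)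

swapOn-∘ : (s t : Fin n → Bool) → ∀ e → swapOn s (swapOn t e) ≡ swapOn (λ u → s u xor t u) e
swapOn-∘ s t (u , ι) = cong (u ,_) (swapWhen-xor (s u) (t u) ι)

swapOn-empty : {s : Fin n → Bool} → (∀ u → s u ≡ false) → ∀ e → swapOn s e ≡ e
swapOn-empty s≗0 (u , ι) = cong (λ b → u , swapWhen b ι) (s≗0 u)

combination-swapOn : (s : Fin n → Bool) (U : Ground n → Bool) (Y : Ground n → Fin m → Bool) →
                     ∀ j → combination (U ∘ swapOn s) Y j ≡ combination U (Y ∘ swapOn s) j
combination-swapOn s U Y j = xorSum-cong λ u → begin
  cellSum (λ ι → U (u , swapWhen (s u) ι) ∧ Y (u , ι) j)
    ≡⟨ cellSum-swapWhen (s u) (λ ι → U (u , swapWhen (s u) ι) ∧ Y (u , ι) j) ⟨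
  cellSum (λ ι → U (u , swapWhen (s u) (swapWhen (s u) ι)) ∧ Y (u , swapWhen (s u) ι) j)
    ≡⟨ cellSum-cong (λ ι → cong (λ κ → U (u , κ) ∧ Y (u , swapWhen (s u) ι) j) (swapWhen-involutive (s u) ι)) ⟩
  cellSum (λ ι → U (u , ι) ∧ Y (u , swapWhen (s u) ι) j) ∎
  where open ≡-Reasoning

relabel : Fin n ↔ Fin m → Ground n → Ground m
relabel σ (v , ι) = Inverse.to σ v , ι

relabel-inverseˡ : (σ : Fin n ↔ Fin m) → ∀ e → relabel σ (relabel (↔-sym σ) e) ≡ e
relabel-inverseˡ σ (u , κ) = cong (_, κ) (Inverse.strictlyInverseˡ σ u)

relabel-inverseʳ : (σ : Fin n ↔ Fin m) → ∀ e → relabel (↔-sym σ) (relabel σ e) ≡ e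
relabel-inverseʳ σ (v , ι) = cong (_, ι) (Inverse.strictlyInverseʳ σ v)

combination-relabel : (σ : Fin n ↔ Fin m) (U : Ground m → Bool) (Y : Ground m → Fin m → Bool) →
                      ∀ j → combination U Y j ≡ combination (U ∘ relabel σ) (Y ∘ relabel σ) j
combination-relabel σ U Y j = xorSum-permute (λ u → cellSum λ ι → U (u , ι) ∧ Y (u , ι) j) σ

-- Transport of independence along a map of ground sets

-- Subsets of the ground set of B are pulled back along g; MatroidIso.preserve is exactly
-- Transports A B (Inverse.from bij).
Transports : Adj n → Adj m → (Ground m → Ground n) → Set
Transports A B g = ∀ T → (Independent A T → Independent B (T ∘ g)) × (Independent B (T ∘ g) → Independent A T)

Independent-cong : {A : Adj n} {T T′ : Ground n → Bool} → (∀ e → T e ≡ T′ e) → Independent A T → Independent A T′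
Independent-cong T≗T′ indep U U⊆T′ ΣU≡0 = indep U (λ e Ue → trans (T≗T′ e) (U⊆T′ e Ue)) ΣU≡0

Transports-refl : {A : Adj n} → Transports A A id
Transports-refl T = id , id

Transports-cong : {A : Adj n} {B : Adj m} {g h : Ground m → Ground n} →
                  (∀ e → g e ≡ h e) → Transports A B g → Transports A B h
Transports-cong {g = g} {h} g≗h tr T =
  (λ indA → Independent-cong T∘g≗T∘h (proj₁ (tr T) indA)) ,
  (λ indB → proj₂ (tr T) (Independent-cong (sym ∘ T∘g≗T∘h) indB))
  where
  T∘g≗T∘h : ∀ e → T (g e) ≡ T (h e)
  T∘g≗T∘h e = cong T (g≗h e)

Transports-∘ : ∀ {k} {A : Adj n} {B : Adj m} {C : Adj k} {g : Ground m → Ground n} {h : Ground k → Ground m} →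
               Transports A B g → Transports B C h → Transports A C (g ∘ h)
Transports-∘ trAB trBC T =
  proj₁ (trBC (T ∘ _)) ∘ proj₁ (trAB T) , proj₂ (trAB T) ∘ proj₂ (trBC (T ∘ _))

Transports-sym : {A : Adj n} {B : Adj m} {g : Ground m → Ground n} {g⁻¹ : Ground n → Ground m} →
                 (∀ e → g⁻¹ (g e) ≡ e) → Transports A B g → Transports B A g⁻¹
Transports-sym {g = g} {g⁻¹} inverse tr T =
  (λ indB → proj₂ (tr (T ∘ g⁻¹)) (Independent-cong (λ e → cong T (sym (inverse e))) indB)) ,
  (λ indA → Independent-cong (λ e → cong T (inverse e)) (proj₁ (tr (T ∘ g⁻¹)) indA))

transports-via-linear-map : {A : Adj n} {B : Adj m} {g : Ground m → Ground n} {g⁻¹ : Ground n → Ground m}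
  (L : (Fin n → Bool) → Fin m → Bool) →
  (∀ x → (∀ i → x i ≡ false) → ∀ j → L x j ≡ false) →
  (∀ x → (∀ j → L x j ≡ false) → ∀ i → x i ≡ false) →
  (∀ U j → L (sumColumns A U) j ≡ sumColumns B (U ∘ g) j) →
  (∀ e → g (g⁻¹ e) ≡ e) → (∀ e → g⁻¹ (g e) ≡ e) →
  Transports A B g
transports-via-linear-map {A = A} {B} {g} {g⁻¹} L L-zero L-kernel key right-inverse left-inverse T = preserve , reflect
  where
  preserve : Independent A T → Independent B (T ∘ g)
  preserve indA U U⊆T∘g ΣU≡0 e =
    trans (cong U (sym (left-inverse e))) (indA (U ∘ g⁻¹) U∘g⁻¹⊆T ΣU∘g⁻¹≡0 (g e))
    where
    U∘g⁻¹⊆T : ∀ e → U (g⁻¹ e) ≡ true → T e ≡ true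
    U∘g⁻¹⊆T e Ue = subst (λ e′ → T e′ ≡ true) (right-inverse e) (U⊆T∘g (g⁻¹ e) Ue)
    ΣU∘g⁻¹≡0 : ∀ i → sumColumns A (U ∘ g⁻¹) i ≡ false
    ΣU∘g⁻¹≡0 = L-kernel (sumColumns A (U ∘ g⁻¹)) λ j →
      trans (key (U ∘ g⁻¹) j)
            (trans (combination-cong {Y = column B} (λ e → cong U (left-inverse e)) (λ _ _ → refl) j) (ΣU≡0 j))
  reflect : Independent B (T ∘ g) → Independent A T
  reflect indB U U⊆T ΣU≡0 e =
    trans (cong U (sym (right-inverse e)))
          (indB (U ∘ g) (U⊆T ∘ g) (λ j → trans (sym (key U j)) (L-zero _ ΣU≡0 j)) (g⁻¹ e))

column-relabel : {H : Adj n} {G : Adj m} (σ : Fin n ↔ Fin m) →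
                 (∀ x y → H x y ≡ G (Inverse.to σ x) (Inverse.to σ y)) →
                 ∀ e j → column G (relabel σ e) (Inverse.to σ j) ≡ column H e j
column-relabel σ H≅G (k , φ) j = ==-injective (Injection.injective (Inverse⇒Injection σ)) j k
column-relabel σ H≅G (k , χ) j = sym (H≅G j k)
column-relabel {G = G} σ H≅G (k , ψ) j =
  cong₂ _xor_ (column-relabel {G = G} σ H≅G (k , φ) j) (column-relabel {G = G} σ H≅G (k , χ) j)

relabel-transports : {H : Adj n} {G : Adj m} → ((σ , _) : GraphIso H G) → Transports G H (relabel σ)
relabel-transports {n = n} {m} {H} {G} (σ , H≅G) =
  transports-via-linear-map (λ y i → y (to i)) (λ y y≗0 i → y≗0 (to i)) kernel key
                            (relabel-inverseˡ σ) (relabel-inverseʳ σ)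
  where
  to : Fin n → Fin m
  to = Inverse.to σ
  kernel : ∀ y → (∀ i → y (to i) ≡ false) → ∀ j → y j ≡ false
  kernel y y∘to≗0 j = trans (cong y (sym (Inverse.strictlyInverseˡ σ j))) (y∘to≗0 (Inverse.from σ j))
  key : ∀ U i → sumColumns G U (to i) ≡ sumColumns H (U ∘ relabel σ) i
  key U i = trans (combination-relabel σ U (column G) (to i))
                  (combination-cong {U = U ∘ relabel σ} (λ _ → refl) (column-relabel {G = G} σ H≅G) i)

-- Sets of columns that detect edges

sumColumns-noψ : (A : Adj n) (U : Ground n → Bool) → (∀ u → U (u , ψ) ≡ false) →
                 ∀ i → sumColumns A U i ≡ U (i , φ) xor xorSum (λ u → U (u , χ) ∧ A i u)
sumColumns-noψ {n} A U noψ i = begin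
  sumColumns A U i
    ≡⟨ xorSum-cong (λ u → cong (λ b → Uφ u xor (Uχ u xor (b ∧ column A (u , ψ) i))) (noψ u)) ⟩
  xorSum (λ u → Uφ u xor (Uχ u xor false))
    ≡⟨ xorSum-cong (λ u → cong (Uφ u xor_) (xor-identityʳ (Uχ u))) ⟩
  xorSum (λ u → Uφ u xor Uχ u)
    ≡⟨ xorSum-xor Uφ Uχ ⟩
  xorSum Uφ xor xorSum Uχ
    ≡⟨ cong (_xor xorSum Uχ) (xorSum-single Uφ i (λ u u≢i → trans (cong (U (u , φ) ∧_) (==-≢ (u≢i ∘ sym))) (∧-zeroʳ _))) ⟩
  (U (i , φ) ∧ (i == i)) xor xorSum Uχ
    ≡⟨ cong (λ b → (U (i , φ) ∧ b) xor xorSum Uχ) (==-refl i) ⟩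
  (U (i , φ) ∧ true) xor xorSum Uχ
    ≡⟨ cong (_xor xorSum Uχ) (∧-identityʳ (U (i , φ))) ⟩
  U (i , φ) xor xorSum Uχ ∎
  where
  open ≡-Reasoning
  Uφ Uχ : Fin n → Bool
  Uφ u = U (u , φ) ∧ (i == u)
  Uχ u = U (u , χ) ∧ A i u

sumColumns-singleχ : (A : Adj n) (U : Ground n → Bool) (y : Fin n) →
                  (∀ u → U (u , ψ) ≡ false) → (∀ u → u ≢ y → U (u , χ) ≡ false) →
                  ∀ i → sumColumns A U i ≡ U (i , φ) xor (U (y , χ) ∧ A i y)
sumColumns-singleχ A U y noψ noχ i =
  trans (sumColumns-noψ A U noψ i)
        (cong (U (i , φ) xor_) (xorSum-single _ y (λ u u≢y → cong (_∧ A i u) (noχ u u≢y))))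

φ-cells-independent : (A : Adj n) (T : Ground n → Bool) →
                      (∀ u → T (u , χ) ≡ false) → (∀ u → T (u , ψ) ≡ false) → Independent A T
φ-cells-independent A T noχ noψ U U⊆T ΣU≡0 = λ where
    (u , φ) → begin
      U (u , φ)                                               ≡⟨ xor-identityʳ _ ⟨
      U (u , φ) xor false                                     ≡⟨ cong (U (u , φ) xor_) (xorSum-zero (λ w → cong (_∧ A u w) (Uχ≡0 w))) ⟨
      U (u , φ) xor xorSum (λ w → U (w , χ) ∧ A u w)          ≡⟨ sumColumns-noψ A U Uψ≡0 u ⟨
      sumColumns A U u                                        ≡⟨ ΣU≡0 u ⟩
      false                                                   ∎
    (u , χ) → Uχ≡0 u
    (u , ψ) → Uψ≡0 u
  where
  open ≡-Reasoning
  Uχ≡0 : ∀ u → U (u , χ) ≡ false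
  Uχ≡0 u = ⊆-false (U⊆T (u , χ)) (noχ u)
  Uψ≡0 : ∀ u → U (u , ψ) ≡ false
  Uψ≡0 u = ⊆-false (U⊆T (u , ψ)) (noψ u)

zero-sum-dependent : (A : Adj n) (T : Ground n → Bool) (e : Ground n) → T e ≡ true →
                     (∀ i → sumColumns A T i ≡ false) → ¬ Independent A T
zero-sum-dependent A T e Te≡1 ΣT≡0 indep = not-¬ Te≡1 (indep T (λ _ Te → Te) ΣT≡0 e)

-- The χ-column of y is the sum of the φ-columns of the neighbours of y.
neighbourhoodCircuit : Adj n → Fin n → Ground n → Bool
neighbourhoodCircuit X y (u , φ) = X u y
neighbourhoodCircuit X y (u , χ) = u == y
neighbourhoodCircuit X y (u , ψ) = false

neighbourhoodCircuit-dependent : (X : Adj n) (y : Fin n) → ¬ Independent X (neighbourhoodCircuit X y)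
neighbourhoodCircuit-dependent X y = zero-sum-dependent X C (y , χ) (==-refl y) ΣC≡0
  where
  C : Ground _ → Bool
  C = neighbourhoodCircuit X y
  ΣC≡0 : ∀ i → sumColumns X C i ≡ false
  ΣC≡0 i = begin
    sumColumns X C i               ≡⟨ sumColumns-singleχ X C y (λ _ → refl) (λ _ → ==-≢) i ⟩
    X i y xor ((y == y) ∧ X i y)   ≡⟨ cong (λ b → X i y xor (b ∧ X i y)) (==-refl y) ⟩
    X i y xor X i y                ≡⟨ xor-same (X i y) ⟩
    false                          ∎
    where open ≡-Reasoning

neighbourhoodCircuit-independent : {X Y : Adj n} {x y : Fin n} → X x y ≡ false → Y x y ≡ true →
                                   Independent Y (neighbourhoodCircuit X y)
neighbourhoodCircuit-independent {X = X} {Y} {x} {y} Xxy≡0 Yxy≡1 U U⊆C ΣU≡0 = λ where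
    (u , φ) → trans (Uφ≡Uχ∧Y u) (cong (_∧ Y u y) Uyχ≡0)
    (u , χ) → Uχ≡0 u
    (u , ψ) → Uψ≡0 u
  where
  Uψ≡0 : ∀ u → U (u , ψ) ≡ false
  Uψ≡0 u = ⊆-false (U⊆C (u , ψ)) refl
  Uχ≡0′ : ∀ u → u ≢ y → U (u , χ) ≡ false
  Uχ≡0′ u u≢y = ⊆-false (U⊆C (u , χ)) (==-≢ u≢y)
  Uφ≡Uχ∧Y : ∀ i → U (i , φ) ≡ U (y , χ) ∧ Y i y
  Uφ≡Uχ∧Y i = xor≡false⇒≡ (trans (sym (sumColumns-singleχ Y U y Uψ≡0 Uχ≡0′ i)) (ΣU≡0 i))
  Uyχ≡0 : U (y , χ) ≡ false
  Uyχ≡0 = begin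
    U (y , χ)            ≡⟨ ∧-identityʳ _ ⟨
    U (y , χ) ∧ true     ≡⟨ cong (U (y , χ) ∧_) Yxy≡1 ⟨
    U (y , χ) ∧ Y x y    ≡⟨ Uφ≡Uχ∧Y x ⟨
    U (x , φ)            ≡⟨ ⊆-false (U⊆C (x , φ)) Xxy≡0 ⟩
    false                ∎
    where open ≡-Reasoning
  Uχ≡0 : ∀ u → U (u , χ) ≡ false
  Uχ≡0 u with u ≟ y
  ... | yes refl = Uyχ≡0
  ... | no u≢y = Uχ≡0′ u u≢y

edge-reflected : {X Y : Adj n} → Transports X Y id → ∀ {x y} → Y x y ≡ true → X x y ≡ true
edge-reflected {X = X} {Y} tr {x} {y} Yxy≡1 with X x y in Xxy
... | true = refl
... | false = ⊥-elim (neighbourhoodCircuit-dependent X y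
                        (proj₂ (tr (neighbourhoodCircuit X y)) (neighbourhoodCircuit-independent Xxy Yxy≡1)))

adjacency-determined : {X Y : Adj n} → Transports X Y id → ∀ x y → X x y ≡ Y x y
adjacency-determined tr x y =
  ⇔→≡ (mk⇔ (edge-reflected (Transports-sym (λ _ → refl) tr)) (edge-reflected tr))

-- If no vertex of s were adjacent to v, T = {v_χ} ∪ {u_φ : u ∉ s, u ∼ v} would have zero sum in A,
-- while swapOn s maps it onto φ-cells only.
swapped-neighbour : {A B : Adj n} {s : Fin n → Bool} → Transports A B (swapOn s) →
                    ∀ {v} → s v ≡ true → ∃[ w ] s w ≡ true × A w v ≡ true
swapped-neighbour {n} {A} {B} {s} tr {v} sv≡1
  with any? (λ w → (s w Bool.≟ true) ×-dec (A w v Bool.≟ true))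
... | yes found = found
... | no none = ⊥-elim (zero-sum-dependent A T (v , χ) (==-refl v) ΣT≡0
                          (proj₂ (tr T) (φ-cells-independent B (T ∘ swapOn s) image-noχ image-noψ)))
  where
  T : Ground n → Bool
  T (u , φ) = not (s u) ∧ A u v
  T (u , χ) = u == v
  T (u , ψ) = false
  unswapped-only : ∀ u → s u ≡ true → A u v ≡ false
  unswapped-only u su≡1 = ¬-not (λ Auv≡1 → none (u , su≡1 , Auv≡1))
  image-noχ : ∀ u → T (swapOn s (u , χ)) ≡ false
  image-noχ u with s u in su
  ... | true = cong (λ b → not b ∧ A u v) su
  ... | false = ==-≢ λ { refl → not-¬ sv≡1 su }
  image-noψ : ∀ u → T (swapOn s (u , ψ)) ≡ false
  image-noψ u = cong (λ κ → T (u , κ)) (swapWhen-ψ (s u))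
  ΣT≡0 : ∀ i → sumColumns A T i ≡ false
  ΣT≡0 i = begin
    sumColumns A T i                                ≡⟨ sumColumns-singleχ A T v (λ _ → refl) (λ _ → ==-≢) i ⟩
    (not (s i) ∧ A i v) xor ((v == v) ∧ A i v)      ≡⟨ cong (λ b → (not (s i) ∧ A i v) xor (b ∧ A i v)) (==-refl v) ⟩
    (not (s i) ∧ A i v) xor A i v                   ≡⟨ swapped-part (s i) refl ⟩
    false                                           ∎
    where
    open ≡-Reasoning
    swapped-part : ∀ b → s i ≡ b → (not b ∧ A i v) xor A i v ≡ false
    swapped-part true  si≡1 = unswapped-only i si≡1
    swapped-part false _    = xor-same (A i v)

-- Local complementation and the edge pivot

localComp-entry : ∀ (c : Fin n) A x y → localComp c A x y ≡ (not (x == y) ∧ A c x ∧ A c y) xor A x y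
localComp-entry c A x y = if-not≡xor (not (x == y) ∧ A c x ∧ A c y) (A x y)

localComp-≢ : ∀ (c : Fin n) A {x y} → x ≢ y → localComp c A x y ≡ (A c x ∧ A c y) xor A x y
localComp-≢ c A {x} {y} x≢y =
  trans (localComp-entry c A x y) (cong (λ b → (not b ∧ A c x ∧ A c y) xor A x y) (==-≢ x≢y))

localComp-centre : ∀ (c : Fin n) A → A c c ≡ false → ∀ y → localComp c A c y ≡ A c y
localComp-centre c A Acc≡0 y = begin
  localComp c A c y                             ≡⟨ localComp-entry c A c y ⟩
  (not (c == y) ∧ A c c ∧ A c y) xor A c y      ≡⟨ cong (λ b → (not (c == y) ∧ b ∧ A c y) xor A c y) Acc≡0 ⟩
  (not (c == y) ∧ false) xor A c y              ≡⟨ cong (_xor A c y) (∧-zeroʳ (not (c == y))) ⟩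
  A c y                                         ∎
  where open ≡-Reasoning

localComp-simple : ∀ (c : Fin n) {A} → Simple A → Simple (localComp c A)
localComp-simple c {A} simple = record { irrefl = irrefl ; sym = symmetric }
  where
  irrefl : ∀ x → localComp c A x x ≡ false
  irrefl x rewrite ==-refl x = Simple.irrefl simple x
  symmetric : ∀ x y → localComp c A x y ≡ localComp c A y x
  symmetric x y rewrite localComp-entry c A x y | localComp-entry c A y x
                      | ==-sym x y | ∧-comm (A c x) (A c y) | Simple.sym simple x y = refl

pivot-simple : ∀ (v w : Fin n) {A} → Simple A → Simple (pivot v w A)
pivot-simple v w simple = localComp-simple v (localComp-simple w (localComp-simple v simple))

PivotStep-simple : {A A′ : Adj n} → Simple A → PivotStep A A′ → Simple A′
PivotStep-simple simple (step v w _ _) = pivot-simple v w simple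

pair : Fin n → Fin n → Fin n → Bool
pair v w u = (u == v) xor (u == w)

module _ {A : Adj n} (simple : Simple A) {v w : Fin n} (v≢w : v ≢ w) (Avw≡1 : A v w ≡ true) where

  private
    A₁ A₂ P : Adj n
    A₁ = localComp v A
    A₂ = localComp w A₁
    P  = pivot v w A

    simple₁ : Simple A₁
    simple₁ = localComp-simple v simple
    simple₂ : Simple A₂
    simple₂ = localComp-simple w simple₁
    simpleP : Simple P
    simpleP = localComp-simple v simple₂

    w≢v : w ≢ v
    w≢v = v≢w ∘ sym
    Avv≡0 : A v v ≡ false
    Avv≡0 = Simple.irrefl simple v
    Aww≡0 : A w w ≡ false
    Aww≡0 = Simple.irrefl simple w
    Awv≡1 : A w v ≡ true
    Awv≡1 = trans (Simple.sym simple w v) Avw≡1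

    A₁-w-row : ∀ {y} → y ≢ w → A₁ w y ≡ A v y xor A w y
    A₁-w-row {y} y≢w = trans (localComp-≢ v A (y≢w ∘ sym)) (cong (λ b → (b ∧ A v y) xor A w y) Avw≡1)

    A₁-wv : A₁ w v ≡ true
    A₁-wv = trans (A₁-w-row v≢w) (cong₂ _xor_ Avv≡0 Awv≡1)

    A₂-v-row : ∀ {y} → y ≢ v → y ≢ w → A₂ v y ≡ A w y
    A₂-v-row {y} y≢v y≢w = begin
      A₂ v y                          ≡⟨ localComp-≢ w A₁ (y≢v ∘ sym) ⟩
      (A₁ w v ∧ A₁ w y) xor A₁ v y    ≡⟨ cong₃ (λ a b c → (a ∧ b) xor c) A₁-wv (A₁-w-row y≢w) (localComp-centre v A Avv≡0 y) ⟩
      (A v y xor A w y) xor A v y     ≡⟨ solve 2 (λ a b → (a :+ b) :+ a := b) refl (A v y) (A w y) ⟩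
      A w y                           ∎
      where open ≡-Reasoning

    A₂-vw : A₂ v w ≡ true
    A₂-vw = begin
      A₂ v w                          ≡⟨ localComp-≢ w A₁ v≢w ⟩
      (A₁ w v ∧ A₁ w w) xor A₁ v w    ≡⟨ cong₂ (λ a b → (A₁ w v ∧ a) xor b) (Simple.irrefl simple₁ w) (localComp-centre v A Avv≡0 w) ⟩
      (A₁ w v ∧ false) xor A v w      ≡⟨ cong₂ _xor_ (∧-zeroʳ (A₁ w v)) Avw≡1 ⟩
      true                            ∎
      where open ≡-Reasoning

  pivot-vw : pivot v w A v w ≡ true
  pivot-vw = trans (localComp-centre v A₂ (Simple.irrefl simple₂ v) w) A₂-vw

  pivot-v-row : ∀ {y} → y ≢ v → y ≢ w → pivot v w A v y ≡ A w y
  pivot-v-row {y} y≢v y≢w = trans (localComp-centre v A₂ (Simple.irrefl simple₂ v) y) (A₂-v-row y≢v y≢w)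

  pivot-w-row : ∀ {y} → y ≢ v → y ≢ w → pivot v w A w y ≡ A v y
  pivot-w-row {y} y≢v y≢w = begin
    P w y                              ≡⟨ localComp-≢ v A₂ (y≢w ∘ sym) ⟩
    (A₂ v w ∧ A₂ v y) xor A₂ w y       ≡⟨ cong₃ (λ a b c → (a ∧ b) xor c) A₂-vw (A₂-v-row y≢v y≢w)
                                                (trans (localComp-centre w A₁ (Simple.irrefl simple₁ w) y) (A₁-w-row y≢w)) ⟩
    A w y xor (A v y xor A w y)        ≡⟨ solve 2 (λ a b → b :+ (a :+ b) := a) refl (A v y) (A w y) ⟩
    A v y                              ∎
    where open ≡-Reasoning

  pivot-interior : ∀ {x y} → x ≢ v → x ≢ w → y ≢ v → y ≢ w →
                   pivot v w A x y ≡ A x y xor ((A v y ∧ A w x) xor (A w y ∧ A v x))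
  pivot-interior {x} {y} x≢v x≢w y≢v y≢w = by-equality (x ≟ y)
    where
    open ≡-Reasoning
    by-equality : Dec (x ≡ y) → P x y ≡ A x y xor ((A v y ∧ A w x) xor (A w y ∧ A v x))
    by-equality (yes refl) = begin
      P x x                                              ≡⟨ Simple.irrefl simpleP x ⟩
      false                                              ≡⟨ solve 2 (λ a b → con false := (a :* b) :+ (b :* a)) refl (A v x) (A w x) ⟩
      (A v x ∧ A w x) xor (A w x ∧ A v x)                ≡⟨ cong (_xor ((A v x ∧ A w x) xor (A w x ∧ A v x))) (Simple.irrefl simple x) ⟨
      A x x xor ((A v x ∧ A w x) xor (A w x ∧ A v x))    ∎
    by-equality (no x≢y) = begin
      P x y
        ≡⟨ localComp-≢ v A₂ x≢y ⟩
      (A₂ v x ∧ A₂ v y) xor A₂ x y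
        ≡⟨ cong₃ (λ a b c → (a ∧ b) xor c) (A₂-v-row x≢v x≢w) (A₂-v-row y≢v y≢w) (localComp-≢ w A₁ x≢y) ⟩
      (A w x ∧ A w y) xor ((A₁ w x ∧ A₁ w y) xor A₁ x y)
        ≡⟨ cong₃ (λ a b c → (A w x ∧ A w y) xor ((a ∧ b) xor c)) (A₁-w-row x≢w) (A₁-w-row y≢w) (localComp-≢ v A x≢y) ⟩
      (A w x ∧ A w y) xor (((A v x xor A w x) ∧ (A v y xor A w y)) xor ((A v x ∧ A v y) xor A x y))
        ≡⟨ solve 5 (λ ax bx ay by axy →
             (bx :* by) :+ (((ax :+ bx) :* (ay :+ by)) :+ ((ax :* ay) :+ axy))
             := axy :+ ((ay :* bx) :+ (by :* ax))) refl (A v x) (A w x) (A v y) (A w y) (A x y) ⟩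
      A x y xor ((A v y ∧ A w x) xor (A w y ∧ A v x))
        ∎

  pivot-column-v : ∀ i → pivot v w A i v ≡ (i == v) xor column A (w , ψ) i
  pivot-column-v = by-position v w at-v at-w elsewhere
    where
    at-v : P v v ≡ (v == v) xor ((v == w) xor A v w)
    at-v = trans (Simple.irrefl simpleP v)
                 (sym (cong₃ (λ a b c → a xor (b xor c)) (==-refl v) (==-≢ v≢w) Avw≡1))
    at-w : P w v ≡ (w == v) xor ((w == w) xor A w w)
    at-w = trans (trans (Simple.sym simpleP w v) pivot-vw)
                 (sym (cong₃ (λ a b c → a xor (b xor c)) (==-≢ w≢v) (==-refl w) Aww≡0))
    elsewhere : ∀ i → i ≢ v → i ≢ w → P i v ≡ (i == v) xor ((i == w) xor A i w)
    elsewhere i i≢v i≢w = begin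
      P i v                                ≡⟨ Simple.sym simpleP i v ⟩
      P v i                                ≡⟨ pivot-v-row i≢v i≢w ⟩
      A w i                                ≡⟨ Simple.sym simple w i ⟩
      A i w                                ≡⟨ cong₂ (λ a b → a xor (b xor A i w)) (==-≢ i≢v) (==-≢ i≢w) ⟨
      (i == v) xor ((i == w) xor A i w)    ∎
      where open ≡-Reasoning

  pivot-column-w : ∀ i → pivot v w A i w ≡ (i == w) xor column A (v , ψ) i
  pivot-column-w = by-position v w at-v at-w elsewhere
    where
    at-v : P v w ≡ (v == w) xor ((v == v) xor A v v)
    at-v = trans pivot-vw (sym (cong₃ (λ a b c → a xor (b xor c)) (==-≢ v≢w) (==-refl v) Avv≡0))
    at-w : P w w ≡ (w == w) xor ((w == v) xor A w v)
    at-w = trans (Simple.irrefl simpleP w)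
                 (sym (cong₃ (λ a b c → a xor (b xor c)) (==-refl w) (==-≢ w≢v) Awv≡1))
    elsewhere : ∀ i → i ≢ v → i ≢ w → P i w ≡ (i == w) xor ((i == v) xor A i v)
    elsewhere i i≢v i≢w = begin
      P i w                                ≡⟨ Simple.sym simpleP i w ⟩
      P w i                                ≡⟨ pivot-w-row i≢v i≢w ⟩
      A v i                                ≡⟨ Simple.sym simple v i ⟩
      A i v                                ≡⟨ cong₂ (λ a b → a xor (b xor A i v)) (==-≢ i≢w) (==-≢ i≢v) ⟨
      (i == w) xor ((i == v) xor A i v)    ∎
      where open ≡-Reasoning

  pivot-column : ∀ {u} → u ≢ v → u ≢ w → ∀ i →
    pivot v w A i u ≡ A i u xor ((A v u ∧ column A (w , ψ) i) xor (A w u ∧ column A (v , ψ) i))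
  pivot-column {u} u≢v u≢w = by-position v w at-v at-w elsewhere
    where
    open ≡-Reasoning
    Q : Fin n → Bool → Bool → Bool → Bool → Bool
    Q i a b c d = A i u xor ((A v u ∧ (a xor b)) xor (A w u ∧ (c xor d)))
    at-v : P v u ≡ Q v (v == w) (A v w) (v == v) (A v v)
    at-v = begin
      P v u                      ≡⟨ pivot-v-row u≢v u≢w ⟩
      A w u                      ≡⟨ solve 2 (λ a b → b := a :+ ((a :* con true) :+ (b :* con true))) refl (A v u) (A w u) ⟩
      Q v false true true false  ≡⟨ cong₂ (λ a b → Q v a true true b) (==-≢ v≢w) Avv≡0 ⟨
      Q v (v == w) true true (A v v)
                                 ≡⟨ cong₂ (λ a b → Q v (v == w) a b (A v v)) Avw≡1 (==-refl v) ⟨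
      Q v (v == w) (A v w) (v == v) (A v v) ∎
    at-w : P w u ≡ Q w (w == w) (A w w) (w == v) (A w v)
    at-w = begin
      P w u                      ≡⟨ pivot-w-row u≢v u≢w ⟩
      A v u                      ≡⟨ solve 2 (λ a b → a := b :+ ((a :* con true) :+ (b :* con true))) refl (A v u) (A w u) ⟩
      Q w true false false true  ≡⟨ cong₂ (λ a b → Q w a b false true) (==-refl w) Aww≡0 ⟨
      Q w (w == w) (A w w) false true
                                 ≡⟨ cong₂ (λ a b → Q w (w == w) (A w w) a b) (==-≢ w≢v) Awv≡1 ⟨
      Q w (w == w) (A w w) (w == v) (A w v) ∎
    elsewhere : ∀ i → i ≢ v → i ≢ w → P i u ≡ Q i (i == w) (A i w) (i == v) (A i v)
    elsewhere i i≢v i≢w = begin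
      P i u                                  ≡⟨ pivot-interior i≢v i≢w u≢v u≢w ⟩
      Q i false (A w i) false (A v i)        ≡⟨ cong₂ (λ a b → Q i false a false b) (Simple.sym simple w i) (Simple.sym simple v i) ⟩
      Q i false (A i w) false (A i v)        ≡⟨ cong₂ (λ a b → Q i a (A i w) b (A i v)) (==-≢ i≢w) (==-≢ i≢v) ⟨
      Q i (i == w) (A i w) (i == v) (A i v)  ∎

  pivotMap : (Fin n → Bool) → Fin n → Bool
  pivotMap = addMultiples v w (column A (w , ψ)) (column A (v , ψ))

  pivotMap-v : ∀ x → pivotMap x v ≡ x w
  pivotMap-v x rewrite ==-≢ v≢w | Avw≡1 | ==-refl v | Avv≡0 =
    solve 2 (λ a b → a :+ ((a :* con true) :+ (b :* con true)) := b) refl (x v) (x w)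

  pivotMap-w : ∀ x → pivotMap x w ≡ x v
  pivotMap-w x rewrite ==-refl w | Aww≡0 | ==-≢ w≢v | Awv≡1 =
    solve 2 (λ a b → b :+ ((a :* con true) :+ (b :* con true)) := a) refl (x v) (x w)


  private
    ψw ψv : Fin n → Bool
    ψw = column A (w , ψ)
    ψv = column A (v , ψ)

    CellImages : Fin n → Bool → Set
    CellImages u b = ∀ ι i → pivotMap (column A (u , ι)) i ≡ column P (u , swapWhen b ι) i

    cell-images : ∀ {u} b → (∀ i → pivotMap (column A (u , φ)) i ≡ column P (u , swapWhen b φ) i) →
                  (∀ i → pivotMap (column A (u , χ)) i ≡ column P (u , swapWhen b χ) i) → CellImages u b
    cell-images b φ-image χ-image φ = φ-image
    cell-images b φ-image χ-image χ = χ-image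
    cell-images {u} b φ-image χ-image ψ i = begin
      pivotMap (column A (u , ψ)) i
        ≡⟨ addMultiples-xor v w ψw ψv (column A (u , φ)) (column A (u , χ)) i ⟩
      pivotMap (column A (u , φ)) i xor pivotMap (column A (u , χ)) i
        ≡⟨ cong₂ _xor_ (φ-image i) (χ-image i) ⟩
      column P (u , swapWhen b φ) i xor column P (u , swapWhen b χ) i
        ≡⟨ column-ψ P u b i ⟩
      column P (u , swapWhen b ψ) i ∎
      where open ≡-Reasoning

    cell-images-v : CellImages v true
    cell-images-v = cell-images true φ-image χ-image
      where
      open ≡-Reasoning
      φ-image : ∀ i → pivotMap (column A (v , φ)) i ≡ P i v
      φ-image i = begin
        (i == v) xor (((v == v) ∧ ψw i) xor ((w == v) ∧ ψv i))
          ≡⟨ cong₂ (λ a b → (i == v) xor ((a ∧ ψw i) xor (b ∧ ψv i))) (==-refl v) (==-≢ w≢v) ⟩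
        (i == v) xor (ψw i xor false)  ≡⟨ cong ((i == v) xor_) (xor-identityʳ (ψw i)) ⟩
        (i == v) xor ψw i              ≡⟨ pivot-column-v i ⟨
        P i v                          ∎
      χ-image : ∀ i → pivotMap (column A (v , χ)) i ≡ (i == v)
      χ-image i = begin
        A i v xor ((A v v ∧ ψw i) xor (A w v ∧ ψv i))
          ≡⟨ cong₂ (λ a b → A i v xor ((a ∧ ψw i) xor (b ∧ ψv i))) Avv≡0 Awv≡1 ⟩
        A i v xor ((i == v) xor A i v)  ≡⟨ solve 2 (λ a b → a :+ (b :+ a) := b) refl (A i v) (i == v) ⟩
        (i == v)                         ∎

    cell-images-w : CellImages w true
    cell-images-w = cell-images true φ-image χ-image
      where
      open ≡-Reasoning
      φ-image : ∀ i → pivotMap (column A (w , φ)) i ≡ P i w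
      φ-image i = begin
        (i == w) xor (((v == w) ∧ ψw i) xor ((w == w) ∧ ψv i))
          ≡⟨ cong₂ (λ a b → (i == w) xor ((a ∧ ψw i) xor (b ∧ ψv i))) (==-≢ v≢w) (==-refl w) ⟩
        (i == w) xor ψv i              ≡⟨ pivot-column-w i ⟨
        P i w                          ∎
      χ-image : ∀ i → pivotMap (column A (w , χ)) i ≡ (i == w)
      χ-image i = begin
        A i w xor ((A v w ∧ ψw i) xor (A w w ∧ ψv i))
          ≡⟨ cong₂ (λ a b → A i w xor ((a ∧ ψw i) xor (b ∧ ψv i))) Avw≡1 Aww≡0 ⟩
        A i w xor (((i == w) xor A i w) xor false)
          ≡⟨ solve 2 (λ a b → a :+ ((b :+ a) :+ con false) := b) refl (A i w) (i == w) ⟩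
        (i == w)                         ∎

    cell-images-elsewhere : ∀ u → u ≢ v → u ≢ w → CellImages u false
    cell-images-elsewhere u u≢v u≢w = cell-images false φ-image (λ i → sym (pivot-column u≢v u≢w i))
      where
      open ≡-Reasoning
      φ-image : ∀ i → pivotMap (column A (u , φ)) i ≡ (i == u)
      φ-image i = begin
        (i == u) xor (((v == u) ∧ ψw i) xor ((w == u) ∧ ψv i))
          ≡⟨ cong₂ (λ a b → (i == u) xor ((a ∧ ψw i) xor (b ∧ ψv i))) (==-≢ (u≢v ∘ sym)) (==-≢ (u≢w ∘ sym)) ⟩
        (i == u) xor false               ≡⟨ xor-identityʳ (i == u) ⟩
        (i == u)                         ∎

  pivotMap-column : ∀ e i → pivotMap (column A e) i ≡ column (pivot v w A) (swapOn (pair v w) e) i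
  pivotMap-column (u , ι) = by-position {P = λ u → CellImages u (pair v w u)} v w
    (subst (CellImages v) (sym (cong₂ _xor_ (==-refl v) (==-≢ v≢w))) cell-images-v)
    (subst (CellImages w) (sym (cong₂ _xor_ (==-≢ w≢v) (==-refl w))) cell-images-w)
    (λ u u≢v u≢w → subst (CellImages u) (sym (cong₂ _xor_ (==-≢ u≢v) (==-≢ u≢w))) (cell-images-elsewhere u u≢v u≢w))
    u ι

  pivot-transports : Transports A (pivot v w A) (swapOn (pair v w))
  pivot-transports = transports-via-linear-map pivotMap pivotMap-zero pivotMap-kernel key
                              (swapOn-involutive (pair v w)) (swapOn-involutive (pair v w))
    where
    pivotMap-zero : ∀ x → (∀ i → x i ≡ false) → ∀ j → pivotMap x j ≡ false
    pivotMap-zero x x≗0 j = cong₃ (λ a b c → a xor ((b ∧ ψw j) xor (c ∧ ψv j))) (x≗0 j) (x≗0 v) (x≗0 w)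
    pivotMap-kernel : ∀ x → (∀ j → pivotMap x j ≡ false) → ∀ i → x i ≡ false
    pivotMap-kernel x Lx≗0 i = begin
      x i                                                ≡⟨ xor-identityʳ (x i) ⟨
      x i xor false                                      ≡⟨ cong₂ (λ a b → x i xor ((a ∧ ψw i) xor (b ∧ ψv i))) xv≡0 xw≡0 ⟨
      x i xor ((x v ∧ ψw i) xor (x w ∧ ψv i))            ≡⟨ Lx≗0 i ⟩
      false                                              ∎
      where
      open ≡-Reasoning
      xv≡0 : x v ≡ false
      xv≡0 = trans (sym (pivotMap-w x)) (Lx≗0 w)
      xw≡0 : x w ≡ false
      xw≡0 = trans (sym (pivotMap-v x)) (Lx≗0 v)
    key : ∀ U j → pivotMap (sumColumns A U) j ≡ sumColumns (pivot v w A) (U ∘ swapOn (pair v w)) j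
    key U j = begin
      pivotMap (sumColumns A U) j
        ≡⟨ addMultiples-combination v w ψw ψv U (column A) j ⟩
      combination U (pivotMap ∘ column A) j
        ≡⟨ combination-cong {U = U} (λ _ → refl) pivotMap-column j ⟩
      combination U (column P ∘ swapOn (pair v w)) j
        ≡⟨ combination-swapOn (pair v w) U (column P) j ⟨
      sumColumns P (U ∘ swapOn (pair v w)) j ∎
      where open ≡-Reasoning

-- Pivots versus compatible isomorphisms

transport-from-pivots : {A H : Adj n} → Simple A → Pivots A H → ∃[ s ] Transports A H (swapOn s)
transport-from-pivots simple ε =
  (λ _ → false) , Transports-cong (λ e → sym (swapOn-empty (λ _ → refl) e)) Transports-refl
transport-from-pivots simple (step v w v≢w Avw≡1 ◅ path)
  with transport-from-pivots (pivot-simple v w simple) path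
... | s , tr = (λ u → pair v w u xor s u) ,
               Transports-cong (swapOn-∘ (pair v w) s) (Transports-∘ (pivot-transports simple v≢w Avw≡1) tr)

size : (Fin n → Bool) → ℕ
size {ℕ.zero}  s = 0
size {ℕ.suc n} s = if s zero then ℕ.suc (size (s ∘ suc)) else size (s ∘ suc)

size-cong : {s t : Fin n → Bool} → (∀ u → s u ≡ t u) → size s ≡ size t
size-cong {ℕ.zero}  s≗t = refl
size-cong {ℕ.suc n} s≗t = cong₂ (λ b k → if b then ℕ.suc k else k) (s≗t zero) (size-cong (s≗t ∘ suc))

toggle : Fin n → (Fin n → Bool) → Fin n → Bool
toggle a s u = (u == a) xor s u

size-toggle : (s : Fin n → Bool) (a : Fin n) → s a ≡ true → ℕ.suc (size (toggle a s)) ≡ size s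
size-toggle s zero sa≡1 rewrite sa≡1 = refl
size-toggle s (suc a) sa≡1
  rewrite size-cong {t = toggle a (s ∘ suc)} (λ i → cong (_xor s (suc i)) (==-injective suc-injective i a))
  with s zero
... | true  = cong ℕ.suc (size-toggle (s ∘ suc) a sa≡1)
... | false = size-toggle (s ∘ suc) a sa≡1

pivot-removing-swaps : {A B : Adj n} {s : Fin n → Bool} → Simple A → Transports A B (swapOn s) →
                       ∀ {v} → s v ≡ true →
                       ∃[ A′ ] ∃[ s′ ] PivotStep A A′ × Transports A′ B (swapOn s′) × size s′ < size s
pivot-removing-swaps {n} {A} {B} {s} simple tr {v} sv≡1 with swapped-neighbour tr sv≡1
... | w , sw≡1 , Awv≡1 = pivot w v A , s′ , step w v w≢v Awv≡1 , tr′ , shrinks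
  where
  w≢v : w ≢ v
  w≢v refl = not-¬ (Simple.irrefl simple w) Awv≡1
  s′ : Fin n → Bool
  s′ u = pair w v u xor s u
  tr′ : Transports (pivot w v A) B (swapOn s′)
  tr′ = Transports-cong (swapOn-∘ (pair w v) s)
          (Transports-∘ (Transports-sym {g⁻¹ = swapOn (pair w v)} (swapOn-involutive (pair w v))
                                        (pivot-transports simple w≢v Awv≡1))
                        tr)
  shrinks : size s′ < size s
  shrinks = begin-strict
    size s′                          ≡⟨ size-cong (λ u → xor-assoc (u == w) (u == v) (s u)) ⟩
    size (toggle w (toggle v s))     <⟨ ℕ.n<1+n _ ⟩
    ℕ.suc (size (toggle w (toggle v s)))
                                     ≡⟨ size-toggle (toggle v s) w (trans (cong (_xor s w) (==-≢ w≢v)) sw≡1) ⟩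
    size (toggle v s)                <⟨ ℕ.n<1+n _ ⟩
    ℕ.suc (size (toggle v s))        ≡⟨ size-toggle s v sv≡1 ⟩
    size s                           ∎
    where open ℕ.≤-Reasoning

pivots-from-transport : {A B : Adj n} {s : Fin n → Bool} → Simple A → Transports A B (swapOn s) →
                        Acc _<_ (size s) → ∃[ H ] Pivots A H × (∀ x y → H x y ≡ B x y)
pivots-from-transport {n} {A} {B} {s} simple tr (acc smaller) = by-cases (any? (λ v → s v Bool.≟ true))
  where
  by-cases : Dec (∃[ v ] s v ≡ true) → ∃[ H ] Pivots A H × (∀ x y → H x y ≡ B x y)
  by-cases (no none) =
    A , ε , adjacency-determined (Transports-cong (swapOn-empty λ u → ¬-not λ su → none (u , su)) tr)
  by-cases (yes (v , sv≡1)) =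
    let A′ , s′ , pivotStep , tr′ , shrinks = pivot-removing-swaps simple tr sv≡1
        H , path , H≗B = pivots-from-transport (PivotStep-simple simple pivotStep) tr′ (smaller shrinks)
    in  H , pivotStep ◅ path , H≗B

swapFlag : {f : Cell → Cell} → InIdOrφχ f → Bool
swapFlag (inj₁ _) = false
swapFlag (inj₂ _) = true

swapFlag-correct : {f : Cell → Cell} (f∈ : InIdOrφχ f) → ∀ ι → f ι ≡ swapWhen (swapFlag f∈) ι
swapFlag-correct (inj₁ f≗id) = f≗id
swapFlag-correct (inj₂ f≗swap) = f≗swap

compatible-iso : {G₁ : Adj n} {G₂ : Adj m} (σ : Fin n ↔ Fin m) (s : Fin n → Bool) →
                 Transports G₁ G₂ (swapOn s ∘ relabel (↔-sym σ)) →
                 ∃[ b ] (Compatible {A = G₁} {B = G₂} b × (∀ v → InIdOrφχ (fβ b v)))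
compatible-iso {n} {m} σ s tr =
  record { bij = mk↔ₛ′ to′ (swapOn s ∘ relabel (↔-sym σ)) to∘from from∘to ; preserve = tr } ,
  (Inverse.to σ , λ _ _ → refl) ,
  (λ v → swapWhen-InIdOrφχ (s v))
  where
  to′ : Ground n → Ground m
  to′ (v , ι) = Inverse.to σ v , swapWhen (s v) ι
  to∘from : ∀ e → to′ (swapOn s (relabel (↔-sym σ) e)) ≡ e
  to∘from (u , κ) = cong₂ _,_ (Inverse.strictlyInverseˡ σ u) (swapWhen-involutive (s (Inverse.from σ u)) κ)
  from∘to : ∀ e → swapOn s (relabel (↔-sym σ) (to′ e)) ≡ e
  from∘to (v , ι) with Inverse.from σ (Inverse.to σ v) | Inverse.strictlyInverseʳ σ v
  ... | .v | refl = cong (v ,_) (swapWhen-involutive (s v) ι)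

pullback : Fin n ↔ Fin m → Adj m → Adj n
pullback σ G x y = G (Inverse.to σ x) (Inverse.to σ y)

compatible-transport : {G₁ : Adj n} {G₂ : Adj m} (b : MatroidIso G₁ G₂) → Compatible b →
                       (∀ v → InIdOrφχ (fβ b v)) →
                       ∃[ σ ] ∃[ s ] Transports G₁ (pullback σ G₂) (swapOn s)
compatible-transport {n} {m} {G₁} {G₂} b (σ-map , β-vertex) shape =
  σ , s , Transports-cong from-relabel
                  (Transports-∘ (MatroidIso.preserve b) (relabel-transports (σ , λ _ _ → refl)))
  where
  open MatroidIso b using (β)
  from : Ground m → Ground n
  from = Inverse.from (MatroidIso.bij b)
  s : Fin n → Bool
  s v = swapFlag (shape v)
  β-formula : ∀ v ι → β (v , ι) ≡ (σ-map v , swapWhen (s v) ι)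
  β-formula v ι = cong₂ _,_ (β-vertex v ι) (swapFlag-correct (shape v) ι)
  from-formula : ∀ v κ → from (σ-map v , κ) ≡ (v , swapWhen (s v) κ)
  from-formula v κ = begin
    from (σ-map v , κ)                                    ≡⟨ cong (λ c → from (σ-map v , c)) (swapWhen-involutive (s v) κ) ⟨
    from (σ-map v , swapWhen (s v) (swapWhen (s v) κ))    ≡⟨ cong from (β-formula v (swapWhen (s v) κ)) ⟨
    from (β (v , swapWhen (s v) κ))                       ≡⟨ Inverse.strictlyInverseʳ (MatroidIso.bij b) _ ⟩
    v , swapWhen (s v) κ                                  ∎
    where open ≡-Reasoning
  σ : Fin n ↔ Fin m
  σ = mk↔ₛ′ σ-map (λ u → proj₁ (from (u , φ)))
        (λ u → trans (sym (β-vertex _ _)) (cong proj₁ (Inverse.strictlyInverseˡ (MatroidIso.bij b) (u , φ))))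
        (λ v → cong proj₁ (from-formula v φ))
  from-relabel : ∀ e → from (relabel σ e) ≡ swapOn s e
  from-relabel (v , κ) = from-formula v κ

corollary15 : ∀ {n m : ℕ} (G₁ : Adj n) (G₂ : Adj m) → Simple G₁ → Simple G₂ →
    PivotEquivalent G₁ G₂ ⇔
      (∃[ b ] (Compatible {A = G₁} {B = G₂} b × (∀ (v : Fin n) → InIdOrφχ (fβ b v))))
corollary15 G₁ G₂ simple₁ _ = mk⇔ pivots⇒compatible compatible⇒pivots
  where
  pivots⇒compatible : PivotEquivalent G₁ G₂ → ∃[ b ] (Compatible b × (∀ v → InIdOrφχ (fβ b v)))
  pivots⇒compatible (H , path , σ , H≅G₂) with transport-from-pivots simple₁ path
  ... | s , tr = compatible-iso σ s (Transports-∘ tr (Transports-sym (relabel-inverseʳ σ) (relabel-transports (σ , H≅G₂))))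
  compatible⇒pivots : ∃[ b ] (Compatible b × (∀ v → InIdOrφχ (fβ b v))) → PivotEquivalent G₁ G₂
  compatible⇒pivots (b , compatible , shape) with compatible-transport b compatible shape
  ... | σ , s , tr with pivots-from-transport simple₁ tr (<-wellFounded (size s))
  ... | H , path , H≗ = H , path , σ , H≗
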